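{- Let $q$ be a prime power, $k\ge 0$, and let $L=L_{q,k}$ be the lattice of subspaces of a $k$-dimensional vector space over $GF(q)$. Suppose every covering of $L$ is colored red or green so that the coloring is matroidal. Then for every pair of subspaces $x\le y$ in $L$, the number of red coverings in a maximal chain $x=x_0<x_1<\dots<x_n=y$ of $L$ is the same for all maximal chains from $x$ to $y$. (This common number is denoted $\rho(x,y)$.)
   Context: A covering of $L$ is a pair $[x,y]$ with $x<y$ and $\dim y=\dim x+1$. A diamond is an interval $[x,z]$ of $L$ with $\dim z=\dim x+2$; its lower coverings are the coverings $[x,y]$ and its upper coverings are the coverings $[y,z]$, for $x<y<z$. A red/green coloring of the coverings of $L$ is matroidal if every diamond is of one of four types: (One) all its coverings are red; (Mixed) exactly one lower covering $[x,y]$ is green, and the covering $[y,z]$ above it is the only red upper covering; (Prime) all lower coverings are red and all upper coverings are green; (Zero) all coverings are green. -}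

module Defs where

open import Level using (0ℓ)
open import Data.Nat using (ℕ; zero; suc; _^_)
open import Data.Nat.Primality using (Prime)
open import Data.Fin using (Fin; zero; suc)
open import Data.Bool using (Bool; true; false)
open import Data.Product using (Σ; ∃; ∃-syntax; _×_; _,_)
open import Data.Sum using (_⊎_)
open import Data.Empty using (⊥)
open import Relation.Nullary using (¬_)
open import Relation.Binary.PropositionalEquality using (_≡_; _≢_)
open import Algebra.Structures using (IsCommutativeRing)
open import Function.Bundles using (_↔_)

record Field : Set₁ where
  infixl 6 _+_
  infixl 7 _*_
  field
    Carrier : Set
    _+_ _*_ : Carrier → Carrier → Carrier
    -_      : Carrier → Carrier
    0# 1#   : Carrier
    isCommutativeRing : IsCommutativeRing _≡_ _+_ _*_ -_ 0# 1#
    0≢1     : 0# ≢ 1#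
    inverse : ∀ a → a ≢ 0# → Σ Carrier λ b → a * b ≡ 1#

IsPrimePower : ℕ → Set
IsPrimePower q = Σ ℕ λ p → Σ ℕ λ e → Prime p × q ≡ p ^ suc e

record GF (q : ℕ) : Set₁ where
  field
    field′   : Field
    counting : Field.Carrier field′ ↔ Fin q

module Subspaces (F : Field) (k : ℕ) where
  open Field F

  V : Set
  V = Fin k → Carrier

  _≈ᵥ_ : V → V → Set
  v ≈ᵥ w = ∀ i → v i ≡ w i

  0ᵥ : V
  0ᵥ _ = 0#

  _+ᵥ_ : V → V → V
  (v +ᵥ w) i = v i + w i

  _·_ : Carrier → V → V
  (a · v) i = a * v i

  lincomb : ∀ {n} → (Fin n → Carrier) → (Fin n → V) → V
  lincomb {zero}  c b = 0ᵥ
  lincomb {suc n} c b = (c zero · b zero) +ᵥ lincomb (λ i → c (suc i)) (λ i → b (suc i))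

  record Subspace : Set₁ where
    field
      mem    : V → Set
      mem-resp : ∀ {v w} → v ≈ᵥ w → mem v → mem w
      mem-0    : mem 0ᵥ
      mem-+    : ∀ {v w} → mem v → mem w → mem (v +ᵥ w)
      mem-·    : ∀ a {v} → mem v → mem (a · v)
  open Subspace public

  _≤_ : Subspace → Subspace → Set
  x ≤ y = ∀ v → mem x v → mem y v

  _≈_ : Subspace → Subspace → Set
  x ≈ y = x ≤ y × y ≤ x

  IsBasis : ∀ {n} → Subspace → (Fin n → V) → Set
  IsBasis x b =
      (∀ i → mem x (b i))
    × (∀ c → lincomb c b ≈ᵥ 0ᵥ → ∀ i → c i ≡ 0#)
    × (∀ v → mem x v → ∃[ c ] lincomb c b ≈ᵥ v)

  HasDim : Subspace → ℕ → Set
  HasDim x n = ∃[ b ] IsBasis {n} x b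

  Covers : Subspace → Subspace → Set
  Covers x y = x ≤ y × ¬ (y ≤ x) × ∃[ n ] (HasDim x n × HasDim y (suc n))

  Diamond : Subspace → Subspace → Set
  Diamond x z = x ≤ z × ∃[ n ] (HasDim x n × HasDim z (suc (suc n)))

  -- Only its values on coverings matter.  Subspaces are represented
  -- extensionally, so a coloring must respect equality of subspaces.
  Coloring : Set₁
  Coloring = Subspace → Subspace → Bool

  RespectsEq : Coloring → Set₁
  RespectsEq col = ∀ {x x′ y y′} → x ≈ x′ → y ≈ y′ → col x y ≡ col x′ y′

  Red Green : Coloring → Subspace → Subspace → Set
  Red   col x y = col x y ≡ true
  Green col x y = col x y ≡ false

  Mid : Subspace → Subspace → Subspace → Set
  Mid x y z = Covers x y × Covers y z

  TypeOne TypeMixed TypePrime TypeZero : Coloring → Subspace → Subspace → Set₁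
  TypeOne col x z = ∀ y → Mid x y z → Red col x y × Red col y z
  TypeMixed col x z = Σ Subspace λ y₀ → Mid x y₀ z
    × Green col x y₀ × Red col y₀ z
    × (∀ y → Mid x y z → ¬ (y ≈ y₀) → Red col x y × Green col y z)
  TypePrime col x z = ∀ y → Mid x y z → Red col x y × Green col y z
  TypeZero col x z = ∀ y → Mid x y z → Green col x y × Green col y z

  Matroidal : Coloring → Set₁
  Matroidal col = ∀ x z → Diamond x z →
    TypeOne col x z ⊎ TypeMixed col x z ⊎ TypePrime col x z ⊎ TypeZero col x z

  data Chain : Subspace → Subspace → Set₁ where
    []  : ∀ {x} → Chain x x
    _∷_ : ∀ {x y z} → Covers x y → Chain y z → Chain x z

  reds : Coloring → ∀ {x y} → Chain x y → ℕ
  reds col [] = 0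
  reds col (_∷_ {x} {y} _ ch) with col x y
  ... | true  = suc (reds col ch)
  ... | false = reds col ch

-- Induction on the length of the first chain.  If the two chains begin with the same
-- covering [x,a], the induction hypothesis applies to their tails.  Otherwise their
-- first steps a ≠ b both cover x, so s = a ∨ b covers a and b and [x,s] is a diamond;
-- continue s by any maximal chain up to y.  By induction each given chain has as many
-- red coverings as the chain through a (resp. b) and s, and in a matroidal colouring
-- the number of red coverings along x < a < s does not depend on the middle element.
-- Dimension theory (the exchange lemma) makes all maximal chains between two
-- subspaces equally long, which is what lets the induction hypothesis apply.
-- Membership of a vector in a subspace is not decidable, so the case distinctions are
-- made under a double negation, which is harmless for an equation between numbers.

module Submission where

open import Defs
open import Level using (Level; 0ℓ)
open import Data.Bool using (Bool; true; false)
open import Data.Nat using (ℕ; zero; suc)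
import Data.Nat as ℕ
import Data.Nat.Properties as ℕP
open import Data.Fin using (Fin; zero; suc; punchIn)
open import Data.Fin.Properties using (¬∀⟶∃¬; sequence; inj⇒≟)
open import Data.Vec.Functional using (tail) renaming (_∷_ to _◂_)
open import Data.Product using (Σ; ∃-syntax; _×_; _,_; proj₁; proj₂; uncurry)
open import Data.Sum using (_⊎_; inj₁; inj₂)
open import Data.Empty using (⊥-elim)
open import Function using (_∘_)
open import Function.Properties.Inverse using (↔⇒↣)
open import Effect.Applicative using (RawApplicative)
open import Effect.Monad using (RawMonad)
open import Relation.Nullary using (¬_; Dec; yes; no)
open import Relation.Nullary.Decidable using (decidable-stable; ¬¬-excluded-middle)
open import Relation.Nullary.Negation using (DoubleNegation; contradiction; negated-stable; ¬¬-map; ¬¬-Monad)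
open import Relation.Binary.PropositionalEquality
open import Relation.Binary.Definitions using (DecidableEquality)
open import Relation.Unary.Properties using (⊆′-refl; ⊆′-trans; ≐′-refl; ≐′-sym; ≐′-trans)
open import Algebra.Bundles using (CommutativeRing)

-- Double negation as a monad whose binds may change universe level, unlike ¬¬-Monad.
private
  variable
    a b : Level
    A : Set a
    B : Set b

  pure : A → ¬ ¬ A
  pure = contradiction

  _>>=_ : ¬ ¬ A → (A → ¬ ¬ B) → ¬ ¬ B
  m >>= f = negated-stable (¬¬-map f m)

  ¬¬-applicative : RawApplicative {0ℓ} DoubleNegation
  ¬¬-applicative = RawMonad.rawApplicative ¬¬-Monad

module FieldProperties (F : Field) where
  open Field F

  commutativeRing : CommutativeRing 0ℓ 0ℓ
  commutativeRing = record { Field F ; _≈_ = _≡_ }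

  open CommutativeRing commutativeRing
    using (*-assoc; *-comm; *-identityˡ; *-identityʳ; zeroˡ; +-identityˡ; -‿inverseʳ; ring; +-abelianGroup)
  open import Algebra.Properties.Ring ring using (-‿distribˡ-*; -‿distribʳ-*)
  open import Algebra.Properties.AbelianGroup +-abelianGroup using (inverseˡ-unique)
  open ≡-Reasoning

  0*x+y≡y : ∀ x y → 0# * x + y ≡ y
  0*x+y≡y x y = trans (cong (_+ y) (zeroˡ x)) (+-identityˡ y)

  solve-for : ∀ {a b x y} → a * b ≡ 1# → a * x + y ≡ 0# → x ≡ (- b) * y
  solve-for {a} {b} {x} {y} ab≡1 ax+y≡0 = begin
    x            ≡⟨ *-identityˡ x ⟨
    1# * x       ≡⟨ cong (_* x) (trans (*-comm b a) ab≡1) ⟨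
    (b * a) * x  ≡⟨ *-assoc b a x ⟩
    b * (a * x)  ≡⟨ cong (b *_) (inverseˡ-unique (a * x) y ax+y≡0) ⟩
    b * (- y)    ≡⟨ -‿distribʳ-* b y ⟨
    - (b * y)    ≡⟨ -‿distribˡ-* b y ⟩
    (- b) * y    ∎

  pivot-cancels : ∀ {p b} m → p * b ≡ 1# → m + (- (m * b)) * p ≡ 0#
  pivot-cancels {p} {b} m pb≡1 = begin
    m + (- (m * b)) * p  ≡⟨ cong (m +_) (-‿distribˡ-* (m * b) p) ⟨
    m + - ((m * b) * p)  ≡⟨ cong (λ z → m + - z) (*-assoc m b p) ⟩
    m + - (m * (b * p))  ≡⟨ cong (λ z → m + - (m * z)) (trans (*-comm b p) pb≡1) ⟩
    m + - (m * 1#)       ≡⟨ cong (λ z → m + - z) (*-identityʳ m) ⟩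
    m + - m              ≡⟨ -‿inverseʳ m ⟩
    0#                   ∎

module Spans (F : Field) (k : ℕ) where
  open Field F
  open FieldProperties F
  open Subspaces F k
  open CommutativeRing commutativeRing
    using (*-assoc; *-comm; distribˡ; distribʳ; zeroˡ; +-identityˡ; +-identityʳ; *-identityˡ;
           +-commutativeSemigroup; +-rawMonoid)
  open import Algebra.Properties.CommutativeSemigroup +-commutativeSemigroup using (interchange; x∙yz≈y∙xz)
  open import Algebra.Definitions.RawMonoid +-rawMonoid using (sum)

  Independent : ∀ {n} → (Fin n → V) → Set
  Independent w = ∀ c → lincomb c w ≈ᵥ 0ᵥ → ∀ j → c j ≡ 0#

  InSpan : ∀ {n} → V → (Fin n → V) → Set
  InSpan v w = ∃[ c ] lincomb c w ≈ᵥ v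

  δ : ∀ {n} → Fin n → Fin n → Carrier
  δ zero    zero    = 1#
  δ zero    (suc j) = 0#
  δ (suc i) zero    = 0#
  δ (suc i) (suc j) = δ i j

  δ-diagonal : ∀ {n} (i : Fin n) → δ i i ≡ 1#
  δ-diagonal zero    = refl
  δ-diagonal (suc i) = δ-diagonal i

  lincomb-cong : ∀ {n} {c d : Fin n → Carrier} (w : Fin n → V) → c ≗ d → lincomb c w ≈ᵥ lincomb d w
  lincomb-cong {zero}  w c≗d r = refl
  lincomb-cong {suc n} w c≗d r =
    cong₂ _+_ (cong (_* w zero r) (c≗d zero)) (lincomb-cong (tail w) (c≗d ∘ suc) r)

  lincomb-0 : ∀ {n} (w : Fin n → V) → lincomb (λ _ → 0#) w ≈ᵥ 0ᵥ
  lincomb-0 {zero}  w r = refl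
  lincomb-0 {suc n} w r = trans (cong (0# * w zero r +_) (lincomb-0 (tail w) r)) (0*x+y≡y _ 0#)

  lincomb-δ : ∀ {n} (i : Fin n) (w : Fin n → V) → lincomb (δ i) w ≈ᵥ w i
  lincomb-δ zero    w r = trans (cong (1# * w zero r +_) (lincomb-0 (tail w) r))
                                (trans (+-identityʳ _) (*-identityˡ _))
  lincomb-δ (suc i) w r = trans (0*x+y≡y _ _) (lincomb-δ i (tail w) r)

  lincomb-+ : ∀ {n} (c d : Fin n → Carrier) (w : Fin n → V) →
    lincomb (λ j → c j + d j) w ≈ᵥ (lincomb c w +ᵥ lincomb d w)
  lincomb-+ {zero}  c d w r = sym (+-identityˡ 0#)
  lincomb-+ {suc n} c d w r =
    trans (cong₂ _+_ (distribʳ (w zero r) (c zero) (d zero)) (lincomb-+ (tail c) (tail d) (tail w) r))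
          (interchange _ _ _ _)

  lincomb-* : ∀ {n} a (c : Fin n → Carrier) (w : Fin n → V) →
    lincomb (λ j → a * c j) w ≈ᵥ (a · lincomb c w)
  lincomb-* {zero}  a c w r = sym (trans (*-comm a 0#) (zeroˡ a))
  lincomb-* {suc n} a c w r =
    trans (cong₂ _+_ (*-assoc a (c zero) (w zero r)) (lincomb-* a (tail c) (tail w) r))
          (sym (distribˡ a _ _))

  lincomb-+ᵥ : ∀ {n} (c : Fin n → Carrier) (v w : Fin n → V) →
    lincomb c (λ j → v j +ᵥ w j) ≈ᵥ (lincomb c v +ᵥ lincomb c w)
  lincomb-+ᵥ {zero}  c v w r = sym (+-identityˡ 0#)
  lincomb-+ᵥ {suc n} c v w r =
    trans (cong₂ _+_ (distribˡ (c zero) (v zero r) (w zero r)) (lincomb-+ᵥ (tail c) (tail v) (tail w) r))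
          (interchange _ _ _ _)

  lincomb-multiples : ∀ {n} (c a : Fin n → Carrier) (u : V) →
    lincomb c (λ j → a j · u) ≈ᵥ (sum (λ j → c j * a j) · u)
  lincomb-multiples {zero}  c a u r = sym (zeroˡ (u r))
  lincomb-multiples {suc n} c a u r =
    trans (cong₂ _+_ (sym (*-assoc (c zero) (a zero) (u r))) (lincomb-multiples (tail c) (tail a) u r))
          (sym (distribʳ (u r) _ _))

  lincomb-punchIn : ∀ {n} (i : Fin (suc n)) (c : Fin (suc n) → Carrier) (w : Fin (suc n) → V) →
    lincomb c w ≈ᵥ ((c i · w i) +ᵥ lincomb (c ∘ punchIn i) (w ∘ punchIn i))
  lincomb-punchIn zero            c w r = refl
  lincomb-punchIn {suc n} (suc i) c w r =
    trans (cong (c zero * w zero r +_) (lincomb-punchIn i (tail c) (tail w) r)) (x∙yz≈y∙xz _ _ _)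

  mem-lincomb : ∀ {n} (x : Subspace) {w : Fin n → V} (c : Fin n → Carrier) →
    (∀ j → mem x (w j)) → mem x (lincomb c w)
  mem-lincomb {zero}  x c w∈x = mem-0 x
  mem-lincomb {suc n} x c w∈x = mem-+ x (mem-· x (c zero) (w∈x zero)) (mem-lincomb x (tail c) (w∈x ∘ suc))

  span : ∀ {n} → (Fin n → V) → Subspace
  span w = record
    { mem      = λ v → InSpan v w
    ; mem-resp = λ { v≈v′ (c , cw≈v) → c , λ r → trans (cw≈v r) (v≈v′ r) }
    ; mem-0    = (λ _ → 0#) , lincomb-0 w
    ; mem-+    = λ { (c , cw≈v) (d , dw≈v′) →
                     (λ j → c j + d j) , λ r → trans (lincomb-+ c d w r) (cong₂ _+_ (cw≈v r) (dw≈v′ r)) }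
    ; mem-·    = λ { a (c , cw≈v) → (λ j → a * c j) , λ r → trans (lincomb-* a c w r) (cong (a *_) (cw≈v r)) }
    }

  span-≤ : ∀ {n y} {w : Fin n → V} → (∀ j → mem y (w j)) → span w ≤ y
  span-≤ {y = y} w∈y v (c , cw≈v) = mem-resp y cw≈v (mem-lincomb y c w∈y)

  ∈-span : ∀ {n} (w : Fin n → V) j → mem (span w) (w j)
  ∈-span w j = δ j , lincomb-δ j w

  span-◂-⊇ : ∀ {n} (u : V) {w : Fin n → V} → span w ≤ span (u ◂ w)
  span-◂-⊇ u v (c , cw≈v) = (0# ◂ c) , λ r → trans (0*x+y≡y (u r) _) (cw≈v r)

  basis-≤ : ∀ {n x y} {β : Fin n → V} → IsBasis x β → (∀ j → mem y (β j)) → x ≤ y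
  basis-≤ {y = y} (_ , _ , spans) β∈y v v∈x = span-≤ {y = y} β∈y v (spans v v∈x)

  IsBasis-resp : ∀ {n x x′} {β : Fin n → V} → x ≈ x′ → IsBasis x β → IsBasis x′ β
  IsBasis-resp (x≤x′ , x′≤x) (β∈x , indep , spans) =
    (λ j → x≤x′ _ (β∈x j)) , indep , λ v v∈x′ → spans v (x′≤x v v∈x′)

  HasDim-resp : ∀ {n x x′} → x ≈ x′ → HasDim x n → HasDim x′ n
  HasDim-resp {x = x} {x′} x≈x′ (β , basis) = β , IsBasis-resp {x = x} {x′} x≈x′ basis

module Dimension (F : Field) (_≟_ : DecidableEquality (Field.Carrier F)) (k : ℕ) where
  open Field F
  open FieldProperties F
  open Subspaces F k
  open Spans F k
  open CommutativeRing commutativeRing using (+-comm; +-rawMonoid)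
  open import Algebra.Definitions.RawMonoid +-rawMonoid using (sum)
  open ≡-Reasoning

  independent⇒≉0 : ∀ {n} {w : Fin n → V} → Independent w → ∀ i → ¬ (w i ≈ᵥ 0ᵥ)
  independent⇒≉0 {w = w} indep i wᵢ≈0 =
    0≢1 (trans (sym (indep (δ i) (λ r → trans (lincomb-δ i w r) (wᵢ≈0 r)) i)) (δ-diagonal i))

  independent-◂ : ∀ {n} {w : Fin n → V} {u : V} → Independent w → ¬ InSpan u w → Independent (u ◂ w)
  independent-◂ {w = w} {u} indep u∉w c c[u◂w]≈0 with c zero ≟ 0#
  ... | yes c₀≡0 = λ { zero → c₀≡0 ; (suc j) → indep (tail c) cw≈0 j }
    where
    cw≈0 : lincomb (tail c) w ≈ᵥ 0ᵥ
    cw≈0 r = trans (sym (0*x+y≡y (u r) _))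
                   (trans (cong (λ a → a * u r + lincomb (tail c) w r) (sym c₀≡0)) (c[u◂w]≈0 r))
  ... | no c₀≢0 with inverse (c zero) c₀≢0
  ...   | b , c₀b≡1 = ⊥-elim (u∉w ((λ j → (- b) * c (suc j)) ,
          λ r → trans (lincomb-* (- b) (tail c) w r) (sym (solve-for c₀b≡1 (c[u◂w]≈0 r)))))

  ≉0⇒nonzero-coefficient : ∀ {n} (c : Fin n → Carrier) (w : Fin n → V) →
    ¬ (lincomb c w ≈ᵥ 0ᵥ) → ∃[ j ] c j ≢ 0#
  ≉0⇒nonzero-coefficient {n} c w cw≉0 =
    ¬∀⟶∃¬ n (λ j → c j ≡ 0#) (λ j → c j ≟ 0#)
      (λ c≗0 → cw≉0 (λ r → trans (lincomb-cong w c≗0 r) (lincomb-0 w r)))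

  -- One step of Gaussian elimination: row i of M expresses w i in terms of v, and the
  -- pivot M₀ⱼ clears column j from the other rows, leaving m independent vectors that
  -- are spanned without v j.
  module Elimination {m n} (w : Fin (suc m) → V) (v : Fin (suc n) → V)
    (M : Fin (suc m) → Fin (suc n) → Carrier) (Mv≈w : ∀ i → lincomb (M i) v ≈ᵥ w i)
    (j : Fin (suc n)) {b : Carrier} (pivot : M zero j * b ≡ 1#) where

    t : Fin m → Carrier
    t i = - (M (suc i) j * b)

    w′ : Fin m → V
    w′ i = w (suc i) +ᵥ (t i · w zero)

    M′ : Fin m → Fin (suc n) → Carrier
    M′ i l = M (suc i) l + t i * M zero l

    M′v≈w′ : ∀ i → lincomb (M′ i) v ≈ᵥ w′ i
    M′v≈w′ i r = trans (lincomb-+ (M (suc i)) (λ l → t i * M zero l) v r)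
      (cong₂ _+_ (Mv≈w (suc i) r) (trans (lincomb-* (t i) (M zero) v r) (cong (t i *_) (Mv≈w zero r))))

    w′-in-span : ∀ i → InSpan (w′ i) (v ∘ punchIn j)
    w′-in-span i = (M′ i ∘ punchIn j) , λ r →
      let rest = lincomb (M′ i ∘ punchIn j) (v ∘ punchIn j) r in begin
      rest                   ≡⟨ 0*x+y≡y (v j r) rest ⟨
      0# * v j r + rest      ≡⟨ cong (λ a → a * v j r + rest) (pivot-cancels (M (suc i) j) pivot) ⟨
      M′ i j * v j r + rest  ≡⟨ lincomb-punchIn j (M′ i) v r ⟨
      lincomb (M′ i) v r     ≡⟨ M′v≈w′ i r ⟩
      w′ i r                 ∎

    w′-independent : Independent w → Independent w′
    w′-independent indep d dw′≈0 i = indep (sum (λ l → d l * t l) ◂ d) dw≈0 (suc i)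
      where
      dw≈0 : lincomb (sum (λ l → d l * t l) ◂ d) w ≈ᵥ 0ᵥ
      dw≈0 r = begin
        sum (λ l → d l * t l) * w zero r + lincomb d (tail w) r
          ≡⟨ +-comm _ _ ⟩
        lincomb d (tail w) r + sum (λ l → d l * t l) * w zero r
          ≡⟨ cong (lincomb d (tail w) r +_) (lincomb-multiples d t (w zero) r) ⟨
        lincomb d (tail w) r + lincomb d (λ l → t l · w zero) r
          ≡⟨ lincomb-+ᵥ d (tail w) (λ l → t l · w zero) r ⟨
        lincomb d w′ r
          ≡⟨ dw′≈0 r ⟩
        0# ∎

  pivot-exists : ∀ {m n} (w : Fin (suc m) → V) (v : Fin n → V) → Independent w →
    (w∈v : ∀ i → InSpan (w i) v) → ∃[ j ] proj₁ (w∈v zero) j ≢ 0#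
  pivot-exists w v indep w∈v = ≉0⇒nonzero-coefficient (proj₁ (w∈v zero)) v
    (λ cv≈0 → independent⇒≉0 {w = w} indep zero (λ r → trans (sym (proj₂ (w∈v zero) r)) (cv≈0 r)))

  independent-≤-spanning : ∀ m {n} (w : Fin m → V) (v : Fin n → V) →
    Independent w → (∀ i → InSpan (w i) v) → m ℕ.≤ n
  independent-≤-spanning zero w v _ _ = ℕ.z≤n
  independent-≤-spanning (suc m) {zero} w v indep w∈v with pivot-exists w v indep w∈v
  ... | () , _
  independent-≤-spanning (suc m) {suc n} w v indep w∈v with pivot-exists w v indep w∈v
  ... | j , M₀ⱼ≢0 with inverse (proj₁ (w∈v zero) j) M₀ⱼ≢0
  ...   | b , pivot = ℕ.s≤s (independent-≤-spanning m w′ (v ∘ punchIn j) (w′-independent indep) w′-in-span)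
    where open Elimination w v (proj₁ ∘ w∈v) (proj₂ ∘ w∈v) j pivot

  dim-mono : ∀ {x y m n} → x ≤ y → HasDim x m → HasDim y n → m ℕ.≤ n
  dim-mono {m = m} x≤y (β , β∈x , β-indep , _) (η , _ , _ , η-spans) =
    independent-≤-spanning m β η β-indep (λ i → η-spans _ (x≤y _ (β∈x i)))

  dim-unique : ∀ {x m n} → HasDim x m → HasDim x n → m ≡ n
  dim-unique {x} dm dn = ℕP.≤-antisym (dim-mono {x} {x} ⊆′-refl dm dn) (dim-mono {x} {x} ⊆′-refl dn dm)

  independent⇒spans : ∀ {m b} {w : Fin m → V} → Independent w → (∀ j → mem b (w j)) → HasDim b m →
    ¬ ¬ (b ≤ span w)
  independent⇒spans {m} {b} {w} indep w∈b (η , η-basis@(η∈b , _ , η-spans)) =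
    ¬¬-map (basis-≤ {x = b} {y = span w} η-basis) (sequence ¬¬-applicative ηᵢ∈w)
    where
    ηᵢ∈w : ∀ i → ¬ ¬ InSpan (η i) w
    ηᵢ∈w i ηᵢ∉w = ℕP.<-irrefl refl
      (independent-≤-spanning (suc m) (η i ◂ w) η (independent-◂ indep ηᵢ∉w)
        λ { zero → η-spans _ (η∈b i) ; (suc j) → η-spans _ (w∈b j) })

  ≤-equidimensional : ∀ {m x y} → HasDim x m → HasDim y m → x ≤ y → ¬ ¬ (y ≤ x)
  ≤-equidimensional {x = x} {y} (β , β-basis@(β∈x , β-indep , _)) dy x≤y =
    ¬¬-map (λ y≤β → ⊆′-trans y≤β (span-≤ {y = x} β∈x))
      (independent⇒spans {b = y} β-indep (λ j → x≤y _ (β∈x j)) dy)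

  ≰⇒basis-vector-∉ : ∀ {n x y} {β : Fin n → V} → IsBasis x β → ¬ (x ≤ y) → ¬ ¬ (∃[ j ] ¬ mem y (β j))
  ≰⇒basis-vector-∉ {x = x} {y} β-basis x≰y ∄ =
    sequence ¬¬-applicative (λ j βⱼ∉y → ∄ (j , βⱼ∉y)) (λ β⊆y → x≰y (basis-≤ {x = x} {y} β-basis β⊆y))

  module Adjoin {n u w} {β : Fin n → V} (β-basis : IsBasis u β) (w∉u : ¬ mem u w) where

    adjoin-basis : IsBasis (span (w ◂ β)) (w ◂ β)
    adjoin-basis = ∈-span (w ◂ β) , independent-◂ (proj₁ (proj₂ β-basis)) w∉β , λ v v∈ → v∈
      where
      w∉β : ¬ InSpan w β
      w∉β w∈β = w∉u (span-≤ {y = u} (proj₁ β-basis) w w∈β)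

    adjoin-covers : Covers u (span (w ◂ β))
    adjoin-covers =
      (λ v v∈u → span-◂-⊇ w v (proj₂ (proj₂ β-basis) v v∈u)) ,
      (λ s≤u → w∉u (s≤u w (∈-span (w ◂ β) zero))) ,
      n , (β , β-basis) , (w ◂ β , adjoin-basis)

    adjoin-≤ : ∀ {y} → u ≤ y → mem y w → span (w ◂ β) ≤ y
    adjoin-≤ {y} u≤y w∈y = span-≤ {y = y} {w ◂ β} λ { zero → w∈y ; (suc j) → u≤y _ (proj₁ β-basis j) }

module Chains (F : Field) (_≟_ : DecidableEquality (Field.Carrier F)) (k : ℕ) where
  open Subspaces F k
  open Spans F k
  open Dimension F _≟_ k

  len : ∀ {x y} → Chain x y → ℕ
  len []      = 0
  len (_ ∷ c) = suc (len c)

  chain-≤ : ∀ {x y} → Chain x y → x ≤ y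
  chain-≤ []              = ⊆′-refl
  chain-≤ ((x≤a , _) ∷ c) = ⊆′-trans x≤a (chain-≤ c)

  ∷-not-closed : ∀ {x a y} → Covers x a → Chain a y → ¬ (y ≤ x)
  ∷-not-closed (_ , a≰x , _) c y≤x = a≰x (⊆′-trans (chain-≤ c) y≤x)

  covers-dim : ∀ {x a n} → Covers x a → HasDim x n → HasDim a (suc n)
  covers-dim {x} {a} (_ , _ , _ , dx , da) dx′ = subst (HasDim a ∘ suc) (dim-unique {x} dx dx′) da

  chain-dim : ∀ {x y n} (c : Chain x y) → HasDim x n → HasDim y (len c ℕ.+ n)
  chain-dim [] dx = dx
  chain-dim {x} {y} {n} (_∷_ {y = a} p c) dx =
    subst (HasDim y) (ℕP.+-suc (len c) n) (chain-dim c (covers-dim {x} {a} p dx))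

  len-unique : ∀ {x y x′ y′ n} → HasDim x n → x ≈ x′ → y ≈ y′ →
    (c₁ : Chain x y) (c₂ : Chain x′ y′) → len c₁ ≡ len c₂
  len-unique {x} {y} {x′} {y′} {n} dx x≈x′ y≈y′ c₁ c₂ = ℕP.+-cancelʳ-≡ n _ _
    (dim-unique {y} (chain-dim c₁ dx)
      (HasDim-resp {x = y′} {y} (≐′-sym y≈y′) (chain-dim c₂ (HasDim-resp {x = x} {x′} x≈x′ dx))))

  Covers-respˡ : ∀ {x x′ a} → x ≈ x′ → Covers x′ a → Covers x a
  Covers-respˡ {x} {x′} x≈x′@(x≤x′ , _) (x′≤a , a≰x′ , n , dx′ , da) =
    ⊆′-trans x≤x′ x′≤a , (λ a≤x → a≰x′ (⊆′-trans a≤x x≤x′)) , n ,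
    HasDim-resp {x = x′} {x} (≐′-sym x≈x′) dx′ , da

  covers-diamond : ∀ {x a s} → Covers x a → Covers a s → Diamond x s
  covers-diamond {x} {a} {s} (x≤a , _ , n , dx , da) a⋖s =
    ⊆′-trans x≤a (proj₁ a⋖s) , n , dx , covers-dim {a} {s} a⋖s da

  covers-≤⇒≈ : ∀ {x a b} → Covers x a → Covers x b → b ≤ a → ¬ ¬ (a ≈ b)
  covers-≤⇒≈ {x} {a} {b} (_ , _ , _ , dx , da) x⋖b b≤a =
    ¬¬-map (_, b≤a) (≤-equidimensional {x = b} {a} (covers-dim {x} {b} x⋖b dx) da b≤a)

  -- Chains are indexed by their exact endpoints, while subspaces are only determined up to ≈.
  ChainUpTo : Subspace → Subspace → Set₁
  ChainUpTo u y = Σ Subspace λ y′ → y′ ≈ y × Chain u y′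

  extend-chain : ∀ d {u y p} → HasDim u p → HasDim y (p ℕ.+ d) → u ≤ y → ¬ ¬ ChainUpTo u y
  extend-chain zero {u} {y} {p} du dy u≤y =
    ¬¬-map (λ y≤u → u , (u≤y , y≤u) , [])
      (≤-equidimensional {x = u} {y} du (subst (HasDim y) (ℕP.+-identityʳ p) dy) u≤y)
  extend-chain (suc d) {u} {y} {p} (β , β-basis) (η , η-basis) u≤y = do
    (j , ηⱼ∉u) ← ≰⇒basis-vector-∉ {x = y} {u} η-basis y≰u
    let open Adjoin {u = u} β-basis ηⱼ∉u
    (y′ , y′≈y , c) ← extend-chain d {span (η j ◂ β)} {y} (η j ◂ β , adjoin-basis)
                        (subst (HasDim y) (ℕP.+-suc p d) (η , η-basis)) (adjoin-≤ {y} u≤y (proj₁ η-basis j))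
    pure (y′ , y′≈y , adjoin-covers ∷ c)
    where
    y≰u : ¬ (y ≤ u)
    y≰u y≤u = ℕP.m≢1+m+n p (trans
      (dim-unique {u} (β , β-basis) (HasDim-resp {x = y} {u} (y≤u , u≤y) (η , η-basis))) (ℕP.+-suc p d))

  chain-up-to : ∀ {u y p r} → HasDim u p → HasDim y r → u ≤ y → ¬ ¬ ChainUpTo u y
  chain-up-to {u} {y} du dy u≤y with ℕP.m≤n⇒∃[o]m+o≡n (dim-mono {u} {y} u≤y du dy)
  ... | d , p+d≡r = extend-chain d {u} {y} du (subst (HasDim y) (sym p+d≡r) dy) u≤y

  -- The join a ∨ b is spanned by a basis of a together with a vector of b outside a.
  module Join {x a b n} {β : Fin n → V} {α γ : Fin (suc n) → V}
    (β-basis : IsBasis x β) (x≤a : x ≤ a) (α-basis : IsBasis a α) (x≤b : x ≤ b) (γ-basis : IsBasis b γ)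
    (b≰a : ¬ (b ≤ a)) (j : Fin (suc n)) (γⱼ∉a : ¬ mem a (γ j)) where
    open Adjoin {u = a} α-basis γⱼ∉a

    join : Subspace
    join = span (γ j ◂ α)

    a⋖join : Covers a join
    a⋖join = adjoin-covers

    join-least : ∀ {y} → a ≤ y → b ≤ y → join ≤ y
    join-least {y} a≤y b≤y = adjoin-≤ {y} a≤y (b≤y _ (proj₁ γ-basis j))

    b≤join : ¬ ¬ (b ≤ join)
    b≤join = ¬¬-map (λ b≤span → ⊆′-trans b≤span (span-≤ {y = join} {γ j ◂ β} γβ∈join))
               (independent⇒spans {b = b} (independent-◂ (proj₁ (proj₂ β-basis)) γⱼ∉x) γβ∈b (γ , γ-basis))
      where
      γⱼ∉x : ¬ InSpan (γ j) β
      γⱼ∉x γⱼ∈x = γⱼ∉a (x≤a _ (span-≤ {y = x} (proj₁ β-basis) _ γⱼ∈x))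
      γβ∈b : ∀ i → mem b ((γ j ◂ β) i)
      γβ∈b zero    = proj₁ γ-basis j
      γβ∈b (suc i) = x≤b _ (proj₁ β-basis i)
      γβ∈join : ∀ i → mem join ((γ j ◂ β) i)
      γβ∈join zero    = ∈-span (γ j ◂ α) zero
      γβ∈join (suc i) = proj₁ a⋖join _ (x≤a _ (proj₁ β-basis i))

    b⋖join : b ≤ join → Covers b join
    b⋖join b≤s = b≤s , s≰b , suc n , (γ , γ-basis) , (γ j ◂ α , adjoin-basis)
      where
      s≰b : ¬ (join ≤ b)
      s≰b s≤b = ≤-equidimensional {x = a} {b} (α , α-basis) (γ , γ-basis) (⊆′-trans (proj₁ a⋖join) s≤b) b≰a

  join-of-covers : ∀ {x a b} → Covers x a → Covers x b → ¬ (b ≤ a) →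
    ¬ ¬ (Σ Subspace λ s → Covers a s × Covers b s × (∀ {y} → a ≤ y → b ≤ y → s ≤ y))
  join-of-covers {x} {a} {b} (x≤a , _ , n , (β , β-basis) , (α , α-basis)) x⋖b b≰a
    with covers-dim {x} {b} x⋖b (β , β-basis)
  ... | γ , γ-basis = do
    (j , γⱼ∉a) ← ≰⇒basis-vector-∉ {x = b} {a} γ-basis b≰a
    let open Join {x} {a} {b} β-basis x≤a α-basis (proj₁ x⋖b) γ-basis b≰a j γⱼ∉a
    b≤s ← b≤join
    pure (join , a⋖join , b⋖join b≤s , λ {y} → join-least {y})

bit : Bool → ℕ
bit true  = 1
bit false = 0

module RedCount (F : Field) (_≟_ : DecidableEquality (Field.Carrier F)) (k : ℕ)
  (col : Subspaces.Coloring F k) (resp : Subspaces.RespectsEq F k col) (matroidal : Subspaces.Matroidal F k col)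
  where
  open Subspaces F k
  open Chains F _≟_ k
  open import Data.Nat using (_+_)
  open ≡-Reasoning

  reds-∷ : ∀ {x a y} (p : Covers x a) (c : Chain a y) → reds col (_∷_ {x} p c) ≡ bit (col x a) + reds col c
  reds-∷ {x} {a} p c with col x a
  ... | true  = refl
  ... | false = refl

  weight : Subspace → Subspace → Subspace → ℕ
  weight x a s = bit (col x a) + bit (col a s)

  reds-∷∷ : ∀ x {a s y} (q : Covers a s) (c : Chain s y) →
    bit (col x a) + reds col (_∷_ {a} q c) ≡ weight x a s + reds col c
  reds-∷∷ x {a} {s} q c =
    trans (cong (bit (col x a) +_) (reds-∷ q c)) (sym (ℕP.+-assoc (bit (col x a)) (bit (col a s)) (reds col c)))

  DiamondType : Subspace → Subspace → Set₁
  DiamondType x s = TypeOne col x s ⊎ TypeMixed col x s ⊎ TypePrime col x s ⊎ TypeZero col x s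

  typeWeight : ∀ {x s} → DiamondType x s → ℕ
  typeWeight (inj₁ _)               = 2
  typeWeight (inj₂ (inj₁ _))        = 1
  typeWeight (inj₂ (inj₂ (inj₁ _))) = 1
  typeWeight (inj₂ (inj₂ (inj₂ _))) = 0

  weight-of-colours : ∀ {x a s c₁ c₂} → col x a ≡ c₁ → col a s ≡ c₂ → weight x a s ≡ bit c₁ + bit c₂
  weight-of-colours x-a a-s = cong₂ _+_ (cong bit x-a) (cong bit a-s)

  weight≡typeWeight : ∀ {x a s} (T : DiamondType x s) → Mid x a s → ¬ ¬ (weight x a s ≡ typeWeight T)
  weight≡typeWeight {a = a} (inj₁ one) m = pure (uncurry weight-of-colours (one a m))
  weight≡typeWeight {x} {a} {s} (inj₂ (inj₁ (y₀ , _ , green , red , others))) m =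
    ¬¬-map mixed ¬¬-excluded-middle
    where
    mixed : Dec (a ≈ y₀) → weight x a s ≡ 1
    mixed (yes a≈y₀) = weight-of-colours (trans (resp ≐′-refl a≈y₀) green) (trans (resp a≈y₀ ≐′-refl) red)
    mixed (no  a≉y₀) = uncurry weight-of-colours (others a m a≉y₀)
  weight≡typeWeight {a = a} (inj₂ (inj₂ (inj₁ prime))) m = pure (uncurry weight-of-colours (prime a m))
  weight≡typeWeight {a = a} (inj₂ (inj₂ (inj₂ zero′))) m = pure (uncurry weight-of-colours (zero′ a m))

  weight-unique : ∀ {x a b s} → Diamond x s → Mid x a s → Mid x b s → ¬ ¬ (weight x a s ≡ weight x b s)
  weight-unique {x} {s = s} d x⋖a⋖s x⋖b⋖s = do
    wa ← weight≡typeWeight T x⋖a⋖s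
    wb ← weight≡typeWeight T x⋖b⋖s
    pure (trans wa (sym wb))
    where
    T : DiamondType x s
    T = matroidal x s d

  Invariant : ℕ → Set₁
  Invariant d = ∀ {x y x′ y′} → x ≈ x′ → y ≈ y′ → (c₁ : Chain x y) (c₂ : Chain x′ y′) →
    len c₁ ≡ d → reds col c₁ ≡ reds col c₂

  module InductionStep {d} (ih : Invariant d) {x y x′ y′ a b m} (x≈x′ : x ≈ x′) (y≈y′ : y ≈ y′)
    (x⋖a : Covers x a) (da : HasDim a m) (t₁ : Chain a y) (x′⋖b : Covers x′ b) (t₂ : Chain b y′)
    (len-t₁ : len t₁ ≡ d) where

    x⋖b : Covers x b
    x⋖b = Covers-respˡ {x} {x′} {b} x≈x′ x′⋖b

    same-cover : a ≈ b → bit (col x a) + reds col t₁ ≡ bit (col x′ b) + reds col t₂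
    same-cover a≈b = cong₂ _+_ (cong bit (resp x≈x′ a≈b)) (ih a≈b y≈y′ t₁ t₂ len-t₁)

    detour : ¬ (b ≤ a) → ¬ ¬ (bit (col x a) + reds col t₁ ≡ bit (col x′ b) + reds col t₂)
    detour b≰a = do
      (s , a⋖s , b⋖s , join-least) ← join-of-covers {x} {a} {b} x⋖a x⋖b b≰a
      (y″ , y″≈y , c) ← chain-up-to {s} {y} (covers-dim {a} {s} a⋖s da) (chain-dim t₁ da)
                           (join-least {y} (chain-≤ t₁) (⊆′-trans (chain-≤ t₂) (proj₂ y≈y′)))
      same-weight ← weight-unique (covers-diamond {x} {a} {s} x⋖a a⋖s) (x⋖a , a⋖s) (x⋖b , b⋖s)
      let a⋖s∷c = _∷_ {a} a⋖s c
          b⋖s∷c = _∷_ {b} b⋖s c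
          len-b⋖s∷c = trans (sym (len-unique {a} {y} {a} {y″} da ≐′-refl (≐′-sym y″≈y) t₁ a⋖s∷c)) len-t₁
      pure (begin
        bit (col x a) + reds col t₁     ≡⟨ cong (bit (col x a) +_) (ih ≐′-refl (≐′-sym y″≈y) t₁ a⋖s∷c len-t₁) ⟩
        bit (col x a) + reds col a⋖s∷c  ≡⟨ reds-∷∷ x a⋖s c ⟩
        weight x a s + reds col c       ≡⟨ cong (_+ reds col c) same-weight ⟩
        weight x b s + reds col c       ≡⟨ reds-∷∷ x b⋖s c ⟨
        bit (col x b) + reds col b⋖s∷c  ≡⟨ cong₂ _+_ (cong bit (resp x≈x′ ≐′-refl))
                                             (ih ≐′-refl (≐′-trans y″≈y y≈y′) b⋖s∷c t₂ len-b⋖s∷c) ⟩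
        bit (col x′ b) + reds col t₂    ∎)

    first-steps-agree : ¬ ¬ (bit (col x a) + reds col t₁ ≡ bit (col x′ b) + reds col t₂)
    first-steps-agree = ¬¬-excluded-middle >>= λ where
      (yes b≤a) → ¬¬-map same-cover (covers-≤⇒≈ {x} {a} {b} x⋖a x⋖b b≤a)
      (no  b≰a) → detour b≰a

  reds-invariant-of-length : ∀ d → Invariant d
  reds-invariant-of-length d _ _ [] [] _ = refl
  reds-invariant-of-length d {x′ = x′} x≈x′ y≈y′ [] (p ∷ c) _ =
    ⊥-elim (∷-not-closed {x′} p c (⊆′-trans (proj₂ y≈y′) (proj₁ x≈x′)))
  reds-invariant-of-length d {x} x≈x′ y≈y′ (p ∷ c) [] _ =
    ⊥-elim (∷-not-closed {x} p c (⊆′-trans (proj₁ y≈y′) (proj₂ x≈x′)))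
  reds-invariant-of-length zero _ _ (_ ∷ _) (_ ∷ _) ()
  reds-invariant-of-length (suc d) {x} {x′ = x′} x≈x′ y≈y′
    (_∷_ {y = a} x⋖a@(_ , _ , _ , _ , da) t₁) (_∷_ {y = b} x′⋖b t₂) len≡ = begin
      reds col (x⋖a ∷ t₁)           ≡⟨ reds-∷ x⋖a t₁ ⟩
      bit (col x a) + reds col t₁   ≡⟨ decidable-stable (_ ℕ.≟ _) first-steps-agree ⟩
      bit (col x′ b) + reds col t₂  ≡⟨ reds-∷ x′⋖b t₂ ⟨
      reds col (x′⋖b ∷ t₂)          ∎
    where
    open InductionStep (reds-invariant-of-length d) x≈x′ y≈y′ x⋖a da t₁ x′⋖b t₂ (ℕP.suc-injective len≡)

  reds-invariant : ∀ {x y x′ y′} → x ≈ x′ → y ≈ y′ → (c₁ : Chain x y) (c₂ : Chain x′ y′) →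
    reds col c₁ ≡ reds col c₂
  reds-invariant x≈x′ y≈y′ c₁ c₂ = reds-invariant-of-length (len c₁) x≈x′ y≈y′ c₁ c₂ refl

proposition1 : (q : ℕ) → IsPrimePower q → (𝔽 : GF q) → (k : ℕ) →
    let open Subspaces (GF.field′ 𝔽) k in
    (col : Coloring) → RespectsEq col → Matroidal col →
    ∀ {x y} → x ≤ y → (c₁ c₂ : Chain x y) → reds col c₁ ≡ reds col c₂
proposition1 q _ 𝔽 k col resp matroidal _ c₁ c₂ = reds-invariant ≐′-refl ≐′-refl c₁ c₂
  where
  open RedCount (GF.field′ 𝔽) (inj⇒≟ (↔⇒↣ (GF.counting 𝔽))) k col resp matroidal
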